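{- For every $k\ge1$ there are only finitely many $k$-core hyperchord diagrams (up to relabeling, i.e. only finitely many $n$ and, for each $n$, finitely many $k$-core hyperchord diagrams on $[n]$).
   Context: Vertices $1,\dots,n$ lie counterclockwise on the unit circle. A hyperchord is the convex hull of a non-empty set of vertices; a hyperchord diagram on $[n]$ is a set of distinct hyperchords with vertices in $[n]$. A crossing between distinct hyperchords $U,V$ is a pair of chords $u_1u_2$, $v_1v_2$ with $u_i\in U$, $v_i\in V$ whose relative interiors intersect, counted with multiplicity. A core hyperchord diagram is one in which every hyperchord is involved in a crossing and every vertex belongs to some hyperchord; a $k$-core hyperchord diagram has exactly $k$ crossings. -}

module Defs where

open import Data.Nat using (ℕ; zero; suc; _+_; _<_; _≤_)
import Data.Nat as ℕ
open import Data.Fin using (Fin; toℕ)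
open import Data.Fin.Subset using (Subset; _∈_; Nonempty)
open import Data.Fin.Subset.Properties using (_∈?_)
open import Data.Product using (_×_; _,_; Σ; ∃; ∃-syntax)
open import Data.Sum using (_⊎_)
open import Data.List using (List; []; _∷_; length; lookup; map; filter; cartesianProduct; allFin)
open import Data.Nat.ListAction using (sum)
open import Data.List.Relation.Unary.All using (All)
open import Data.List.Relation.Unary.Unique.Propositional using (Unique)
open import Relation.Nullary using (Dec; ¬_)
open import Relation.Nullary.Decidable using (_×-dec_; _⊎-dec_)
open import Relation.Binary.PropositionalEquality using (_≡_)

-- Vertices 1..n on the circle are encoded as Fin n (vertex i+1 ↦ i), in
-- counterclockwise order.  A hyperchord is (the convex hull of) a non-empty
-- vertex set, encoded by the vertex set itself (Subset n).

-- Chords (a,b) of U and (c,d) of V, written with a < b and c < d (so each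
-- unordered chord is listed once).  Their relative interiors intersect
-- (a proper crossing) iff the endpoints strictly alternate around the circle.
Interleaved : ∀ {n} → Fin n → Fin n → Fin n → Fin n → Set
Interleaved a b c d =
  (toℕ a < toℕ c × toℕ c < toℕ b × toℕ b < toℕ d)
  ⊎ (toℕ c < toℕ a × toℕ a < toℕ d × toℕ d < toℕ b)

IsCrossing : ∀ {n} → Subset n → Subset n →
             (Fin n × Fin n) × (Fin n × Fin n) → Set
IsCrossing U V ((a , b) , (c , d)) =
  a ∈ U × b ∈ U × c ∈ V × d ∈ V ×
  toℕ a < toℕ b × toℕ c < toℕ d × Interleaved a b c d

isCrossing? : ∀ {n} (U V : Subset n) x → Dec (IsCrossing U V x)
isCrossing? U V ((a , b) , (c , d)) =
  (a ∈? U) ×-dec (b ∈? U) ×-dec (c ∈? V) ×-dec (d ∈? V) ×-dec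
  (toℕ a ℕ.<? toℕ b) ×-dec (toℕ c ℕ.<? toℕ d) ×-dec
  (((toℕ a ℕ.<? toℕ c) ×-dec (toℕ c ℕ.<? toℕ b) ×-dec (toℕ b ℕ.<? toℕ d))
   ⊎-dec ((toℕ c ℕ.<? toℕ a) ×-dec (toℕ a ℕ.<? toℕ d) ×-dec (toℕ d ℕ.<? toℕ b)))

chordPairs : ∀ n → List ((Fin n × Fin n) × (Fin n × Fin n))
chordPairs n = cartesianProduct (cartesianProduct (allFin n) (allFin n))
                                (cartesianProduct (allFin n) (allFin n))

crossingsBetween : ∀ {n} → Subset n → Subset n → ℕ
crossingsBetween {n} U V = length (filter (isCrossing? U V) (chordPairs n))

-- A hyperchord diagram on [n]: a finite set of distinct hyperchords,
-- represented by a duplicate-free list of non-empty vertex sets.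
record IsHyperchordDiagram {n : ℕ} (D : List (Subset n)) : Set where
  field
    nonempty : All Nonempty D
    distinct : Unique D

totalCrossings : ∀ {n} → List (Subset n) → ℕ
totalCrossings []      = 0
totalCrossings (U ∷ D) = sum (map (crossingsBetween U) D) + totalCrossings D

EveryHyperchordCrosses : ∀ {n} → List (Subset n) → Set
EveryHyperchordCrosses D =
  (i : Fin (length D)) → ∃[ j ] (¬ i ≡ j × 0 < crossingsBetween (lookup D i) (lookup D j))

CoversVertices : ∀ {n} → List (Subset n) → Set
CoversVertices {n} D = (v : Fin n) → ∃[ i ] (v ∈ lookup D i)

record IsKCore (k : ℕ) {n : ℕ} (D : List (Subset n)) : Set where
  field
    diagram  : IsHyperchordDiagram D
    crosses  : EveryHyperchordCrosses D
    covers   : CoversVertices D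
    exactlyK : totalCrossings D ≡ k

-- Every vertex v of a hyperchord U lies on a chord of U crossing any
-- hyperchord V that U crosses: a crossing chord ab of U against cd of V has
-- one endpoint strictly between c and d and one strictly outside, and v can
-- be joined to whichever of the two lies on the other side of cd. Hence the
-- 4k endpoints of the k crossings cover all n vertices, so n ≤ 4k. For fixed
-- n there are finitely many hyperchords, and a duplicate-free list over a
-- finite type is a permutation of a sublist of a fixed enumeration.
module Submission where

open import Defs
open import Data.Nat using (ℕ; _≤_)
open import Data.Fin.Subset using (Subset)
open import Data.Product using (_×_; ∃; ∃-syntax)
open import Data.List using (List)
open import Data.List.Membership.Propositional using (_∈_)
open import Data.List.Relation.Binary.Permutation.Propositional using (_↭_)

open import Data.Bool using (true; false) renaming (_≟_ to _≟ᵇ_)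
open import Data.Empty using (⊥-elim)
open import Data.Fin using (Fin; toℕ) renaming (zero to fzero; suc to fsuc)
open import Data.Fin.Properties using (toℕ-injective; pigeonhole; <⇒≢)
import Data.Fin.Subset as S
open import Data.List
  using ([]; _∷_; _++_; length; lookup; map; filter; concatMap; deduplicate)
open import Data.List.Properties using (length-++)
open import Data.List.Membership.Propositional.Properties
  using (∈-lookup; ∈-filter⁺; ∈-filter⁻; ∈-cartesianProduct⁺; ∈-allFin;
         ∈-++⁺ˡ; ∈-++⁺ʳ; ∈-map⁺; ∈-concatMap⁺; ∈-deduplicate⁺)
open import Data.List.Membership.Propositional.Properties.WithK using (unique∧set⇒bag)
open import Data.List.Relation.Binary.BagAndSetEquality using (∼bag⇒↭)
open import Data.List.Relation.Unary.Any as Any using (here; there; index)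
open import Data.List.Relation.Unary.Any.Properties using (lookup-index)
open import Data.List.Relation.Unary.Unique.Propositional using (Unique)
open import Data.List.Relation.Unary.Unique.Propositional.Properties using (filter⁺)
open import Data.Nat using (zero; suc; _+_; _*_; _<_; _≤?_)
open import Data.Nat.ListAction using (sum)
open import Data.Nat.Properties using (<-cmp; <-trans; ≰⇒>; *-suc)
open import Data.Product using (_,_; proj₂; swap)
open import Data.Sum using (_⊎_; inj₁; inj₂)
open import Data.Vec using () renaming ([] to []ᵥ; _∷_ to _∷ᵥ_)
open import Data.Vec.Properties using (≡-dec)
open import Function using (_∘_)
open import Function.Bundles using (mk⇔)
open import Relation.Binary.Definitions using (DecidableEquality; tri<; tri≈; tri>)
open import Relation.Binary.PropositionalEquality
  using (_≡_; refl; sym; trans; cong; cong₂; subst; module ≡-Reasoning)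
open import Relation.Nullary using (Dec; yes; no; does; ¬_)

covering⇒n≤length : ∀ {n} (xs : List (Fin n)) → (∀ v → v ∈ xs) → n ≤ length xs
covering⇒n≤length {n} xs covers with n ≤? length xs
... | yes n≤length = n≤length
... | no  n≰length with pigeonhole (≰⇒> n≰length) (index ∘ covers)
... | i , j , i<j , same-index = ⊥-elim (<⇒≢ i<j (begin
  i                            ≡⟨ lookup-index (covers i) ⟩
  lookup xs (index (covers i)) ≡⟨ cong (lookup xs) same-index ⟩
  lookup xs (index (covers j)) ≡⟨ sym (lookup-index (covers j)) ⟩
  j                            ∎))
  where open ≡-Reasoning

module _ {A B : Set} (f : A → List B) where

  ∈-concatMap-∈ : ∀ {xs x y} → x ∈ xs → y ∈ f x → y ∈ concatMap f xs
  ∈-concatMap-∈ x∈xs y∈fx = ∈-concatMap⁺ f (Any.map (λ { refl → y∈fx }) x∈xs)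

  length-concatMap : ∀ xs → length (concatMap f xs) ≡ sum (map (length ∘ f) xs)
  length-concatMap []       = refl
  length-concatMap (x ∷ xs) = trans (length-++ (f x)) (cong (length (f x) +_) (length-concatMap xs))

module _ {A : Set} {P : A → Set} (P? : ∀ x → Dec (P x)) where

  positive-length-filter⇒∃ : ∀ xs → 0 < length (filter P? xs) → ∃ P
  positive-length-filter⇒∃ (x ∷ xs) positive with P? x
  ... | yes px = x , px
  ... | no  _  = positive-length-filter⇒∃ xs positive

module _ {A : Set} where

  subsequences : List A → List (List A)
  subsequences []       = [] ∷ []
  subsequences (x ∷ xs) = map (x ∷_) (subsequences xs) ++ subsequences xs

  filter∈subsequences : ∀ {P : A → Set} (P? : ∀ x → Dec (P x)) xs →
                        filter P? xs ∈ subsequences xs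
  filter∈subsequences P? []       = here refl
  filter∈subsequences P? (x ∷ xs) with does (P? x)
  ... | true  = ∈-++⁺ˡ (∈-map⁺ (x ∷_) (filter∈subsequences P? xs))
  ... | false = ∈-++⁺ʳ _ (filter∈subsequences P? xs)

  module _ (_≟_ : DecidableEquality A) where
    open import Data.List.Membership.DecPropositional _≟_ using (_∈?_)
    open import Data.List.Relation.Unary.Unique.DecPropositional.Properties _≟_
      using (deduplicate-!)

    unique⇒↭-filter : ∀ {xs ys} → Unique xs → Unique ys → (∀ {z} → z ∈ xs → z ∈ ys) →
                      xs ↭ filter (_∈? xs) ys
    unique⇒↭-filter {xs} {ys} !xs !ys xs⊆ys =
      ∼bag⇒↭ (unique∧set⇒bag !xs (filter⁺ (_∈? xs) !ys)
        (mk⇔ (λ z∈xs → ∈-filter⁺ (_∈? xs) {xs = ys} (xs⊆ys z∈xs) z∈xs)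
             (proj₂ ∘ ∈-filter⁻ (_∈? xs) {xs = ys})))

    unique-sublists-finite : ∀ ys → ∃[ L ] (∀ xs → Unique xs → (∀ {z} → z ∈ xs → z ∈ ys) →
                                              ∃[ xs′ ] (xs′ ∈ L × xs ↭ xs′))
    unique-sublists-finite ys = subsequences zs , λ xs !xs xs⊆ys →
      filter (_∈? xs) zs , filter∈subsequences (_∈? xs) zs ,
      unique⇒↭-filter !xs (deduplicate-! ys) (∈-deduplicate⁺ _≟_ ∘ xs⊆ys)
      where zs = deduplicate _≟_ ys

ChordPair : ℕ → Set
ChordPair n = (Fin n × Fin n) × (Fin n × Fin n)

endpoints : ∀ {n} → ChordPair n → List (Fin n)
endpoints ((a , b) , (c , d)) = a ∷ b ∷ c ∷ d ∷ []

length-endpoints : ∀ {n} (xs : List (ChordPair n)) → length (concatMap endpoints xs) ≡ 4 * length xs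
length-endpoints []       = refl
length-endpoints (x ∷ xs) = trans (cong (4 +_) (length-endpoints xs)) (sym (*-suc 4 (length xs)))

∈-endpoints-swap : ∀ {n} {v : Fin n} x → v ∈ endpoints x → v ∈ endpoints (swap x)
∈-endpoints-swap _ (here v≡a)                         = there (there (here v≡a))
∈-endpoints-swap _ (there (here v≡b))                 = there (there (there (here v≡b)))
∈-endpoints-swap _ (there (there (here v≡c)))         = here v≡c
∈-endpoints-swap _ (there (there (there (here v≡d)))) = there (here v≡d)

isCrossing-swap : ∀ {n} {U V : Subset n} x → IsCrossing U V x → IsCrossing V U (swap x)
isCrossing-swap _ (a∈U , b∈U , c∈V , d∈V , a<b , c<d , inj₁ acbd) = c∈V , d∈V , a∈U , b∈U , c<d , a<b , inj₂ acbd
isCrossing-swap _ (a∈U , b∈U , c∈V , d∈V , a<b , c<d , inj₂ cadb) = c∈V , d∈V , a∈U , b∈U , c<d , a<b , inj₁ cadb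

Between : ∀ {n} → Fin n → Fin n → Fin n → Set
Between c d u = toℕ c < toℕ u × toℕ u < toℕ d

Outside : ∀ {n} → Fin n → Fin n → Fin n → Set
Outside c d w = toℕ w < toℕ c ⊎ toℕ d < toℕ w

position : ∀ {n} (c d v : Fin n) → v ≡ c ⊎ v ≡ d ⊎ Between c d v ⊎ Outside c d v
position c d v with <-cmp (toℕ v) (toℕ c)
... | tri≈ _ v≡c _ = inj₁ (toℕ-injective v≡c)
... | tri< v<c _ _ = inj₂ (inj₂ (inj₂ (inj₁ v<c)))
... | tri> _ _ c<v with <-cmp (toℕ v) (toℕ d)
...   | tri≈ _ v≡d _ = inj₂ (inj₁ (toℕ-injective v≡d))
...   | tri< v<d _ _ = inj₂ (inj₂ (inj₁ (c<v , v<d)))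
...   | tri> _ _ d<v = inj₂ (inj₂ (inj₂ (inj₂ d<v)))

module _ {n} {U V : Subset n} where

  crossing⇒between×outside : ∀ {a b c d} → IsCrossing U V ((a , b) , (c , d)) →
    ∃[ u ] ∃[ w ] (u S.∈ U × w S.∈ U × Between c d u × Outside c d w)
  crossing⇒between×outside (a∈U , b∈U , _ , _ , _ , _ , inj₁ (a<c , c<b , b<d)) =
    _ , _ , b∈U , a∈U , (c<b , b<d) , inj₁ a<c
  crossing⇒between×outside (a∈U , b∈U , _ , _ , _ , _ , inj₂ (c<a , a<d , d<b)) =
    _ , _ , a∈U , b∈U , (c<a , a<d) , inj₂ d<b

  between×outside⇒crossing : ∀ {c d u w} → c S.∈ V → d S.∈ V → toℕ c < toℕ d →
    u S.∈ U → w S.∈ U → Between c d u → Outside c d w →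
    ∃[ y ] (IsCrossing U V y × u ∈ endpoints y × w ∈ endpoints y)
  between×outside⇒crossing {c} {d} {u} {w} c∈V d∈V c<d u∈U w∈U (c<u , u<d) (inj₁ w<c) =
    ((w , u) , (c , d)) , (w∈U , u∈U , c∈V , d∈V , <-trans w<c c<u , c<d , inj₁ (w<c , c<u , u<d)) ,
    there (here refl) , here refl
  between×outside⇒crossing {c} {d} {u} {w} c∈V d∈V c<d u∈U w∈U (c<u , u<d) (inj₂ d<w) =
    ((u , w) , (c , d)) , (u∈U , w∈U , c∈V , d∈V , <-trans u<d d<w , c<d , inj₂ (c<u , u<d , d<w)) ,
    here refl , there (here refl)

  vertex-on-crossing : ∀ {v} → v S.∈ U → ∀ x → IsCrossing U V x →
                       ∃[ y ] (IsCrossing U V y × v ∈ endpoints y)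
  vertex-on-crossing {v} v∈U x@(_ , (c , d)) cr@(_ , _ , c∈V , d∈V , _ , c<d , _)
    with crossing⇒between×outside cr | position c d v
  ... | _ , _ , _ , _ , _ , _ | inj₁ v≡c = x , cr , there (there (here v≡c))
  ... | _ , _ , _ , _ , _ , _ | inj₂ (inj₁ v≡d) = x , cr , there (there (there (here v≡d)))
  ... | _ , _ , _ , w∈U , _ , w-outside | inj₂ (inj₂ (inj₁ v-between))
    with between×outside⇒crossing c∈V d∈V c<d v∈U w∈U v-between w-outside
  ...   | y , cr′ , v∈y , _ = y , cr′ , v∈y
  vertex-on-crossing {v} v∈U x@(_ , (c , d)) cr@(_ , _ , c∈V , d∈V , _ , c<d , _)
    | _ , _ , u∈U , _ , u-between , _ | inj₂ (inj₂ (inj₂ v-outside))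
    with between×outside⇒crossing c∈V d∈V c<d u∈U v∈U u-between v-outside
  ...   | y , cr′ , _ , v∈y = y , cr′ , v∈y

crossingList : ∀ {n} → Subset n → Subset n → List (ChordPair n)
crossingList U V = filter (isCrossing? U V) (chordPairs _)

∈-crossingList : ∀ {n} {U V : Subset n} x → IsCrossing U V x → x ∈ crossingList U V
∈-crossingList ((a , b) , (c , d)) =
  ∈-filter⁺ (isCrossing? _ _)
    (∈-cartesianProduct⁺ (∈-cartesianProduct⁺ (∈-allFin a) (∈-allFin b))
                         (∈-cartesianProduct⁺ (∈-allFin c) (∈-allFin d)))

-- Each unordered pair of hyperchords contributes once, with the earlier one first.
crossingsOf : ∀ {n} → List (Subset n) → List (ChordPair n)
crossingsOf []      = []
crossingsOf (U ∷ D) = concatMap (crossingList U) D ++ crossingsOf D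

length-crossingsOf : ∀ {n} (D : List (Subset n)) → length (crossingsOf D) ≡ totalCrossings D
length-crossingsOf []      = refl
length-crossingsOf (U ∷ D) = begin
  length (concatMap (crossingList U) D ++ crossingsOf D)
    ≡⟨ length-++ (concatMap (crossingList U) D) ⟩
  length (concatMap (crossingList U) D) + length (crossingsOf D)
    ≡⟨ cong₂ _+_ (length-concatMap (crossingList U) D) (length-crossingsOf D) ⟩
  totalCrossings (U ∷ D)
    ∎
  where open ≡-Reasoning

crossing∈crossingsOf : ∀ {n} (D : List (Subset n)) (i j : Fin (length D)) → ¬ i ≡ j → ∀ x →
                       IsCrossing (lookup D i) (lookup D j) x →
                       x ∈ crossingsOf D ⊎ swap x ∈ crossingsOf D
crossing∈crossingsOf (U ∷ D) fzero    fzero    i≢j x cr = ⊥-elim (i≢j refl)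
crossing∈crossingsOf (U ∷ D) fzero    (fsuc j) i≢j x cr =
  inj₁ (∈-++⁺ˡ (∈-concatMap-∈ (crossingList U) (∈-lookup {xs = D} j) (∈-crossingList x cr)))
crossing∈crossingsOf (U ∷ D) (fsuc i) fzero    i≢j x cr =
  inj₂ (∈-++⁺ˡ (∈-concatMap-∈ (crossingList U) (∈-lookup {xs = D} i)
                              (∈-crossingList (swap x) (isCrossing-swap x cr))))
crossing∈crossingsOf (U ∷ D) (fsuc i) (fsuc j) i≢j x cr
  with crossing∈crossingsOf D i j (i≢j ∘ cong fsuc) x cr
... | inj₁ x∈  = inj₁ (∈-++⁺ʳ _ x∈)
... | inj₂ x′∈ = inj₂ (∈-++⁺ʳ _ x′∈)

vertex∈endpoints : ∀ {n} {D : List (Subset n)} → CoversVertices D → EveryHyperchordCrosses D →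
                   ∀ v → v ∈ concatMap endpoints (crossingsOf D)
vertex∈endpoints {D = D} covers crosses v with covers v
... | i , v∈Dᵢ with crosses i
... | j , i≢j , positive
    with positive-length-filter⇒∃ (isCrossing? (lookup D i) (lookup D j)) (chordPairs _) positive
... | x , cr with vertex-on-crossing v∈Dᵢ x cr
... | y , cr′ , v∈y with crossing∈crossingsOf D i j i≢j y cr′
... | inj₁ y∈  = ∈-concatMap-∈ endpoints y∈ v∈y
... | inj₂ y′∈ = ∈-concatMap-∈ endpoints y′∈ (∈-endpoints-swap y v∈y)

kCore⇒n≤4k : ∀ {k n} {D : List (Subset n)} → IsKCore k D → n ≤ 4 * k
kCore⇒n≤4k {k} {n} {D} K = subst (n ≤_) length≡4k
  (covering⇒n≤length _ (vertex∈endpoints {D = D} (IsKCore.covers K) (IsKCore.crosses K)))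
  where
  length≡4k : length (concatMap endpoints (crossingsOf D)) ≡ 4 * k
  length≡4k = trans (length-endpoints (crossingsOf D))
                    (cong (4 *_) (trans (length-crossingsOf D) (IsKCore.exactlyK K)))

allSubsets : ∀ n → List (Subset n)
allSubsets zero    = []ᵥ ∷ []
allSubsets (suc n) = map (true ∷ᵥ_) (allSubsets n) ++ map (false ∷ᵥ_) (allSubsets n)

∈-allSubsets : ∀ {n} (U : Subset n) → U ∈ allSubsets n
∈-allSubsets []ᵥ          = here refl
∈-allSubsets (true ∷ᵥ U)  = ∈-++⁺ˡ (∈-map⁺ (true ∷ᵥ_) (∈-allSubsets U))
∈-allSubsets (false ∷ᵥ U) = ∈-++⁺ʳ _ (∈-map⁺ (false ∷ᵥ_) (∈-allSubsets U))

lemma3p17 : (k : ℕ) → 1 ≤ k →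
    (∃[ N ] ((n : ℕ) (D : List (Subset n)) → IsKCore k D → n ≤ N))
    × ((n : ℕ) → ∃[ L ] ((D : List (Subset n)) → IsKCore k D →
         ∃[ D′ ] (D′ ∈ L × D ↭ D′)))
-- The bound n ≤ 4k holds for k = 0 too.
lemma3p17 k _ = (4 * k , λ _ _ → kCore⇒n≤4k) , λ n →
  let L , L-complete = unique-sublists-finite (≡-dec _≟ᵇ_) (allSubsets n) in
  L , λ D K → L-complete D (IsHyperchordDiagram.distinct (IsKCore.diagram K)) (λ {U} _ → ∈-allSubsets U)
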